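{- Let $1\le k\le n$ be integers and let $\tau=\tau_1\cdots\tau_k$ be a permutation of $[k]$. Let $A$ be the set of permutations $a=a_1\cdots a_n$ of $[n]$ (in one-line notation) with $a_1<a_2<\cdots<a_k$. For $a\in A$ define $b(a)$ to be the permutation of $[n]$ whose one-line notation is $a_{\tau_1}a_{\tau_2}\cdots a_{\tau_k}a_{k+1}\cdots a_n$, i.e. the first $k$ entries of $a$ are rearranged so that they form the pattern $\tau$, and the remaining entries are unchanged. For a $k$-element subset $S=\{s_1<\cdots<s_k\}\subseteq[n]$ with complement $[n]\setminus S=\{t_1<\cdots<t_{n-k}\}$ and a permutation $w=w_1\cdots w_n$ of $[n]$, let $\sigma_S(w)$ be the permutation $\pi$ of $[n]$ with $\pi_{s_j}=w_j$ for $1\le j\le k$ and $\pi_{t_j}=w_{k+j}$ for $1\le j\le n-k$. Form the multiset $M$ consisting of $\sigma_S(b(a))$ for every pair $(a,S)$ with $a\in A$ and $S$ a $k$-element subset of $[n]$, each pair contributing once. Then for every permutation $\pi$ of $[n]$, the multiplicity of $\pi$ in $M$ equals the number of occurrences of the pattern $\tau$ in $\pi$.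
   Context: An occurrence of a pattern $\tau$ (a permutation of $[k]$) in a permutation $\pi$ of $[n]$ is a set of positions $i_1<i_2<\cdots<i_k$ such that the entries $\pi_{i_1},\dots,\pi_{i_k}$ are in the same relative order as $\tau_1,\dots,\tau_k$ (i.e. $\pi_{i_j}<\pi_{i_l}$ iff $\tau_j<\tau_l$). The number of occurrences of $\tau$ in $\pi$ is the number of such position sets. A multiset assigns to each element a nonnegative integer multiplicity; the multiplicity of an element in $M$ is the number of pairs $(a,S)$ producing it. -}

module Defs where

open import Data.Nat as ℕ using (ℕ; zero; suc)
open import Data.Bool using (Bool; true; false)
open import Data.Fin using (Fin; _<_; _<?_; inject≤; _≟_)
open import Data.Fin.Properties using (all?)
open import Data.Vec using (Vec; []; _∷_; lookup; toList)
open import Data.List as List using (List; []; _∷_; _++_; take; drop; length; filter; cartesianProduct; allFin)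
open import Data.List.Relation.Unary.Unique.Propositional using (Unique)
open import Data.List.Relation.Unary.AllPairs using (allPairs?)
open import Data.Product using (_×_; _,_)
open import Relation.Nullary using (Dec; ¬?; _×-dec_; _→-dec_)
open import Relation.Nullary.Decidable using (⌊_⌋)
open import Data.List.Properties using (≡-dec)
open import Data.Bool.ListAction using (any)
open import Relation.Binary.PropositionalEquality using (_≡_)

-- One-line notation: a permutation of [n] is a vector of length n with
-- entries in Fin n (values 0..n-1 stand for 1..n) that are pairwise distinct.
IsPerm : ∀ {n} → Vec (Fin n) n → Set
IsPerm v = Unique (toList v)

isPerm? : ∀ {n} (v : Vec (Fin n) n) → Dec (IsPerm v)
isPerm? v = allPairs? (λ x y → ¬? (x ≟ y)) (toList v)

allVec : ∀ {A : Set} → List A → (m : ℕ) → List (Vec A m)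
allVec xs zero = [] ∷ []
allVec xs (suc m) = List.concatMap (λ x → List.map (x ∷_) (allVec xs m)) xs

InA : ∀ {k n} → .(k ℕ.≤ n) → Vec (Fin n) n → Set
InA {k} k≤n a = IsPerm a ×
  ((i j : Fin k) → i < j → lookup a (inject≤ i k≤n) < lookup a (inject≤ j k≤n))

inA? : ∀ {k n} .(k≤n : k ℕ.≤ n) (a : Vec (Fin n) n) → Dec (InA k≤n a)
inA? k≤n a = isPerm? a ×-dec all? (λ i → all? (λ j →
  (i <? j) →-dec (lookup a (inject≤ i k≤n) <? lookup a (inject≤ j k≤n))))

bmap : ∀ {k n} → .(k ℕ.≤ n) → Vec (Fin k) k → Vec (Fin n) n → List (Fin n)
bmap {k} k≤n τ a =
  List.map (λ t → lookup a (inject≤ t k≤n)) (toList τ) ++ drop k (toList a)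

-- A k-element subset S = {s_1 < ... < s_k} of [n] is given by the strictly
-- increasing vector (s_1, ..., s_k).
Increasing : ∀ {k n} → Vec (Fin n) k → Set
Increasing {k} s = (i j : Fin k) → i < j → lookup s i < lookup s j

increasing? : ∀ {k n} (s : Vec (Fin n) k) → Dec (Increasing s)
increasing? s = all? (λ i → all? (λ j → (i <? j) →-dec (lookup s i <? lookup s j)))

memb : ∀ {k n} → Fin n → Vec (Fin n) k → Bool
memb p s = any (λ q → ⌊ p ≟ q ⌋) (toList s)

interleave : ∀ {A : Set} → List Bool → List A → List A → List A
interleave [] xs ys = []
interleave (true ∷ bs) (x ∷ xs) ys = x ∷ interleave bs xs ys
interleave (false ∷ bs) xs (y ∷ ys) = y ∷ interleave bs xs ys
interleave (true ∷ bs) [] ys = []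
interleave (false ∷ bs) xs [] = []

sigma : ∀ {k n} → Vec (Fin n) k → List (Fin n) → List (Fin n)
sigma {k} {n} s w =
  interleave (List.map (λ p → memb p s) (allFin n)) (take k w) (drop k w)

Contributes : ∀ {k n} → .(k ℕ.≤ n) → Vec (Fin k) k → Vec (Fin n) n →
              Vec (Fin n) n × Vec (Fin n) k → Set
Contributes k≤n τ π (a , s) =
  InA k≤n a × Increasing s × (sigma s (bmap k≤n τ a) ≡ toList π)

contributes? : ∀ {k n} .(k≤n : k ℕ.≤ n) (τ : Vec (Fin k) k) (π : Vec (Fin n) n)
               (x : Vec (Fin n) n × Vec (Fin n) k) → Dec (Contributes k≤n τ π x)
contributes? k≤n τ π (a , s) =
  inA? k≤n a ×-dec increasing? s ×-dec
  ≡-dec _≟_ (sigma s (bmap k≤n τ a)) (toList π)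

multiplicity : ∀ {k n} → .(k ℕ.≤ n) → Vec (Fin k) k → Vec (Fin n) n → ℕ
multiplicity {k} {n} k≤n τ π =
  length (filter (contributes? k≤n τ π)
    (cartesianProduct (allVec (allFin n) n) (allVec (allFin n) k)))

Occurrence : ∀ {k n} → Vec (Fin k) k → Vec (Fin n) n → Vec (Fin n) k → Set
Occurrence {k} τ π s = Increasing s ×
  ((i j : Fin k) → (lookup π (lookup s i) < lookup π (lookup s j) → lookup τ i < lookup τ j)
                 × (lookup τ i < lookup τ j → lookup π (lookup s i) < lookup π (lookup s j)))

occurrence? : ∀ {k n} (τ : Vec (Fin k) k) (π : Vec (Fin n) n) (s : Vec (Fin n) k) →
              Dec (Occurrence τ π s)
occurrence? τ π s = increasing? s ×-dec all? (λ i → all? (λ j →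
  ((lookup π (lookup s i) <? lookup π (lookup s j)) →-dec (lookup τ i <? lookup τ j))
  ×-dec ((lookup τ i <? lookup τ j) →-dec (lookup π (lookup s i) <? lookup π (lookup s j)))))

occurrences : ∀ {k n} → Vec (Fin k) k → Vec (Fin n) n → ℕ
occurrences {k} {n} τ π = length (filter (occurrence? τ π) (allVec (allFin n) k))

module Submission where

-- A pair (a , S) produces π exactly when π restricted to S reads a_{τ_1} ⋯ a_{τ_k}
-- and π restricted to the complement of S reads a_{k+1} ⋯ a_n. As a_1 < ⋯ < a_k, the first
-- condition makes π|S order-isomorphic to τ, so S is an occurrence of τ. Conversely, for an
-- occurrence S the two conditions force a_t = π_{s_{τ⁻¹ t}} (t ≤ k) and the rest of a, and this
-- a lies in A. Hence every S contributes 1 or 0 to the multiplicity of π according as it is an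
-- occurrence or not, and summing over S counts the occurrences.

open import Defs
open import Data.Bool using (Bool; true; false; T; T?)
open import Data.Fin as Fin using (Fin; zero; suc; inject≤)
import Data.Fin.Properties as Finₚ
open import Data.List as List using (List; []; _∷_; _++_; length; map; filter; cartesianProduct)
open import Data.List.Membership.Propositional using (_∈_; _∉_)
open import Data.List.Membership.Propositional.Properties
  using (∈-map⁺; ∈-map⁻; ∈-concat⁺′; ∈-filter⁺; ∈-filter⁻; ∈-allFin; ∈-tabulate⁻)
open import Data.List.Properties
  using (length-++; length-map; length-tabulate; filter-++; filter-accept; filter-reject; filter-none;
         map-∘; map-cong; map-tabulate; ∷-injectiveˡ; ∷-injectiveʳ)
open import Data.List.Relation.Binary.Disjoint.Propositional using (Disjoint)
open import Data.List.Relation.Unary.All as All using (All; []; _∷_)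
import Data.List.Relation.Unary.All.Properties as All
open import Data.List.Relation.Unary.AllPairs as AllPairs using (AllPairs; []; _∷_)
import Data.List.Relation.Unary.AllPairs.Properties as AllPairs
open import Data.List.Relation.Unary.Any as Any using (here; there)
open import Data.List.Relation.Unary.Any.Properties using (any⁺; any⁻)
open import Data.List.Relation.Unary.Unique.Propositional using (Unique)
import Data.List.Relation.Unary.Unique.Propositional.Properties as Unique
open import Data.Nat as ℕ using (ℕ; zero; suc; _+_; _≤_)
open import Data.Nat.ListAction using (sum)
import Data.Nat.Properties as ℕₚ
open import Algebra.Properties.CommutativeSemigroup ℕₚ.+-commutativeSemigroup using (interchange)
open import Data.Product using (_×_; _,_; proj₁; proj₂; ∃; map₁; map₂)
open import Data.Vec as Vec using (Vec; []; _∷_; toList; lookup)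
open import Data.Vec.Membership.Propositional.Properties using (∈-lookup; ∈-toList⁺)
open import Data.Vec.Properties
  using (∷-injective; length-toList; lookup∘tabulate; tabulate∘lookup; tabulate-cong; take++drop≡id;
         toList-++; toList-cast; toList∘fromList; toList-injective)
open import Data.Vec.Relation.Binary.Equality.Cast using (cast-is-id)
open import Function using (_∘_; id)
open import Function.Definitions using (Injective)
open import Level using (Level)
open import Relation.Binary using (Rel; Asymmetric; tri<; tri≈; tri>)
open import Relation.Binary.PropositionalEquality
  using (_≡_; _≢_; refl; sym; trans; cong; cong₂; subst; subst₂; module ≡-Reasoning)
open import Relation.Nullary using (Dec; yes; no; contradiction)
open import Relation.Nullary.Decidable using (toWitness; fromWitness)
open import Relation.Unary using (Pred; Decidable)
open import Relation.Unary.Properties using (∁?)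

private
  variable
    A B : Set
    ℓ : Level

indicator : {Q : Set ℓ} → Dec Q → ℕ
indicator (yes _) = 1
indicator (no _)  = 0

count : {P : Pred A ℓ} → Decidable P → List A → ℕ
count P? xs = length (filter P? xs)

module _ {A : Set} {P : Pred A ℓ} (P? : Decidable P) where

  count-∷ : ∀ x xs → count P? (x ∷ xs) ≡ indicator (P? x) + count P? xs
  count-∷ x xs with P? x
  ... | yes _ = refl
  ... | no _  = refl

  count-++ : ∀ xs ys → count P? (xs ++ ys) ≡ count P? xs + count P? ys
  count-++ xs ys = trans (cong length (filter-++ P? xs ys)) (length-++ (filter P? xs))

  count-as-sum : ∀ xs → count P? xs ≡ sum (map (indicator ∘ P?) xs)
  count-as-sum []       = refl
  count-as-sum (x ∷ xs) = trans (count-∷ x xs) (cong (indicator (P? x) +_) (count-as-sum xs))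

  count-map : (f : B → A) (ys : List B) → count P? (map f ys) ≡ sum (map (indicator ∘ P? ∘ f) ys)
  count-map f ys = trans (count-as-sum (map f ys)) (cong sum (sym (map-∘ ys)))

  count-unique : ∀ {x xs} → Unique xs → x ∈ xs → P x → (∀ {y} → P y → y ≡ x) →
                 count P? xs ≡ 1
  count-unique (x∉xs ∷ _) (here refl) Px only =
    cong length (trans (filter-accept P? Px) (cong (_ ∷_) (filter-none P? others-fail)))
    where others-fail = All.map (λ x≢y Py → x≢y (sym (only Py))) x∉xs
  count-unique (y∉ys ∷ u) (there x∈ys) Px only =
    trans (cong length (filter-reject P? (λ Py → All.lookup y∉ys x∈ys (only Py))))
          (count-unique u x∈ys Px only)

sum-map-+ : (f g : A → ℕ) (xs : List A) →
            sum (map (λ x → f x + g x) xs) ≡ sum (map f xs) + sum (map g xs)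
sum-map-+ f g []       = refl
sum-map-+ f g (x ∷ xs) =
  trans (cong (f x + g x +_) (sum-map-+ f g xs)) (interchange (f x) (g x) _ _)

count-cartesianProduct : {P : Pred (A × B) ℓ} (P? : Decidable P) (xs : List A) (ys : List B) →
  count P? (cartesianProduct xs ys) ≡ sum (map (λ y → count (λ x → P? (x , y)) xs) ys)
count-cartesianProduct P? [] []       = refl
count-cartesianProduct P? [] (y ∷ ys) = count-cartesianProduct P? [] ys
count-cartesianProduct P? (x ∷ xs) ys = begin
  count P? (map (x ,_) ys ++ cartesianProduct xs ys)
    ≡⟨ count-++ P? (map (x ,_) ys) _ ⟩
  count P? (map (x ,_) ys) + count P? (cartesianProduct xs ys)
    ≡⟨ cong₂ _+_ (count-map P? (x ,_) ys) (count-cartesianProduct P? xs ys) ⟩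
  sum (map (λ y → indicator (P? (x , y))) ys)
    + sum (map (λ y → count (λ x′ → P? (x′ , y)) xs) ys)
    ≡⟨ sum-map-+ _ _ ys ⟨
  sum (map (λ y → indicator (P? (x , y)) + count (λ x′ → P? (x′ , y)) xs) ys)
    ≡⟨ cong sum (map-cong (λ y → count-∷ (λ x′ → P? (x′ , y)) x xs) ys) ⟨
  sum (map (λ y → count (λ x′ → P? (x′ , y)) (x ∷ xs)) ys) ∎
  where open ≡-Reasoning

allVec-unique : ∀ {xs : List A} → Unique xs → ∀ m → Unique (allVec xs m)
allVec-unique u zero    = [] ∷ []
allVec-unique {xs = xs} u (suc m) =
  Unique.concat⁺
    (All.map⁺ (All.universal (λ _ → Unique.map⁺ (proj₂ ∘ ∷-injective) (allVec-unique u m)) xs))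
    (AllPairs.map⁺ (AllPairs.map heads-differ u))
  where
  heads-differ : ∀ {x y} → x ≢ y →
                 Disjoint (map (x ∷_) (allVec xs m)) (map (y ∷_) (allVec xs m))
  heads-differ x≢y (v∈x , v∈y) with ∈-map⁻ (_ ∷_) v∈x | ∈-map⁻ (_ ∷_) v∈y
  ... | _ , _ , refl | _ , _ , e = x≢y (proj₁ (∷-injective e))

∈-allVec : ∀ {xs : List A} {m} (v : Vec A m) → All (_∈ xs) (toList v) → v ∈ allVec xs m
∈-allVec []      []             = here refl
∈-allVec (x ∷ v) (x∈xs ∷ v⊆xs) =
  ∈-concat⁺′ (∈-map⁺ (x ∷_) (∈-allVec v v⊆xs)) (∈-map⁺ _ x∈xs)

take-++ : ∀ {n} (xs ys : List A) → length xs ≡ n → List.take n (xs ++ ys) ≡ xs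
take-++ []       ys refl = refl
take-++ (x ∷ xs) ys refl = cong (x ∷_) (take-++ xs ys refl)

drop-++ : ∀ {n} (xs ys : List A) → length xs ≡ n → List.drop n (xs ++ ys) ≡ ys
drop-++ []       ys refl = refl
drop-++ (x ∷ xs) ys refl = drop-++ xs ys refl

toList≡tabulate : ∀ {n} (v : Vec A n) → toList v ≡ List.tabulate (lookup v)
toList≡tabulate []      = refl
toList≡tabulate (x ∷ v) = cong (x ∷_) (toList≡tabulate v)

toList≡map-allFin : ∀ {n} (v : Vec A n) → toList v ≡ map (lookup v) (List.allFin n)
toList≡map-allFin v = trans (toList≡tabulate v) (sym (map-tabulate id (lookup v)))

toList-injective-≡ : ∀ {n} {u v : Vec A n} → toList u ≡ toList v → u ≡ v
toList-injective-≡ {u = u} eq = trans (sym (cast-is-id refl u)) (toList-injective refl _ _ eq)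

unique⇒lookup-injective : ∀ {n} (v : Vec A n) → Unique (toList v) → Injective _≡_ _≡_ (lookup v)
unique⇒lookup-injective (x ∷ v) (x∉v ∷ u) {zero}  {zero}  _ = refl
unique⇒lookup-injective (x ∷ v) (x∉v ∷ u) {zero}  {suc j} e =
  contradiction e (All.lookup x∉v (∈-toList⁺ (∈-lookup j v)))
unique⇒lookup-injective (x ∷ v) (x∉v ∷ u) {suc i} {zero}  e =
  contradiction (sym e) (All.lookup x∉v (∈-toList⁺ (∈-lookup i v)))
unique⇒lookup-injective (x ∷ v) (x∉v ∷ u) {suc i} {suc j} e =
  cong suc (unique⇒lookup-injective v u e)

lookup-++-inject≤ : ∀ {k d} (x : Vec A k) (y : Vec A d) (i : Fin k) .(k≤ : k ≤ k + d) →
                    lookup (x Vec.++ y) (inject≤ i k≤) ≡ lookup x i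
lookup-++-inject≤ (a ∷ x) y zero    _  = refl
lookup-++-inject≤ (a ∷ x) y (suc i) k≤ = lookup-++-inject≤ x y i (ℕ.s≤s⁻¹ k≤)

module _ {C : Set} {f : A → C} {g : B → C} where

  map-toList-pointwise⁺ : ∀ {k} (u : Vec A k) (v : Vec B k) →
    (∀ j → f (lookup u j) ≡ g (lookup v j)) → map f (toList u) ≡ map g (toList v)
  map-toList-pointwise⁺ []      []      _  = refl
  map-toList-pointwise⁺ (x ∷ u) (y ∷ v) eq =
    cong₂ _∷_ (eq zero) (map-toList-pointwise⁺ u v (eq ∘ suc))

  map-toList-pointwise⁻ : ∀ {k} (u : Vec A k) (v : Vec B k) →
    map f (toList u) ≡ map g (toList v) → ∀ j → f (lookup u j) ≡ g (lookup v j)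
  map-toList-pointwise⁻ (x ∷ u) (y ∷ v) eq zero    = ∷-injectiveˡ eq
  map-toList-pointwise⁻ (x ∷ u) (y ∷ v) eq (suc j) = map-toList-pointwise⁻ u v (∷-injectiveʳ eq) j

module _ {_<_ : Rel A ℓ} (<-asym : Asymmetric _<_) where

  private
    ⊆-uncons : ∀ {x zs ws} → All (x <_) zs →
               (∀ {z} → z ∈ zs → z ∈ x ∷ ws) → ∀ {z} → z ∈ zs → z ∈ ws
    ⊆-uncons x<zs zs⊆ z∈zs with zs⊆ z∈zs
    ... | here refl  = contradiction (All.lookup x<zs z∈zs) (λ x<x → <-asym x<x x<x)
    ... | there z∈ws = z∈ws

  strictlySorted-unique : ∀ {xs ys} → AllPairs _<_ xs → AllPairs _<_ ys →
    (∀ {z} → z ∈ xs → z ∈ ys) → (∀ {z} → z ∈ ys → z ∈ xs) → xs ≡ ys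
  strictlySorted-unique {[]}     {[]}     _ _ _ _ = refl
  strictlySorted-unique {[]}     {y ∷ ys} _ _ _ ys⊆xs with () ← ys⊆xs (here refl)
  strictlySorted-unique {x ∷ xs} {[]}     _ _ xs⊆ys _ with () ← xs⊆ys (here refl)
  strictlySorted-unique {x ∷ xs} {y ∷ ys} (x<xs ∷ sx) (y<ys ∷ sy) xs⊆ys ys⊆xs
    with xs⊆ys (here refl) | ys⊆xs (here refl)
  ... | there x∈ys | there y∈xs =
    contradiction (All.lookup y<ys x∈ys) (<-asym (All.lookup x<xs y∈xs))
  ... | there x∈ys | here refl  =
    contradiction (All.lookup y<ys x∈ys) (λ x<x → <-asym x<x x<x)
  ... | here refl  | _          = cong (x ∷_)
    (strictlySorted-unique sx sy (⊆-uncons x<xs (xs⊆ys ∘ there)) (⊆-uncons y<ys (ys⊆xs ∘ there)))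

increasing⇒sorted : ∀ {k n} (s : Vec (Fin n) k) → Increasing s → AllPairs Fin._<_ (toList s)
increasing⇒sorted s inc =
  subst (AllPairs Fin._<_) (sym (toList≡tabulate s)) (AllPairs.tabulate⁺-< (inc _ _))

increasing⇒injective : ∀ {k n} (s : Vec (Fin n) k) → Increasing s → Injective _≡_ _≡_ (lookup s)
increasing⇒injective s inc =
  unique⇒lookup-injective s (AllPairs.map Finₚ.<⇒≢ (increasing⇒sorted s inc))

increasing⇒reflects-< : ∀ {k n} (s : Vec (Fin n) k) → Increasing s →
                         ∀ {i j} → lookup s i Fin.< lookup s j → i Fin.< j
increasing⇒reflects-< s inc {i} {j} si<sj with Finₚ.<-cmp i j
... | tri< i<j _ _ = i<j
... | tri≈ _ refl _ = contradiction si<sj (Finₚ.<-irrefl refl)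
... | tri> _ _ j<i = contradiction si<sj (Finₚ.<-asym (inc j i j<i))

-- A value y missed by f would let punchOut y squeeze f into an injection Fin (suc k) → Fin k.
injective⇒surjective : ∀ {k} {f : Fin k → Fin k} → Injective _≡_ _≡_ f →
                       ∀ y → ∃ λ x → f x ≡ y
injective⇒surjective {suc k} {f} f-inj y with Finₚ.any? (λ x → f x Fin.≟ y)
... | yes hit = hit
... | no miss = contradiction (Finₚ.injective⇒≤ punched-inj) (ℕₚ.<-irrefl refl)
  where
  y≢f : ∀ x → y ≢ f x
  y≢f x y≡fx = miss (x , sym y≡fx)
  punched-inj : Injective _≡_ _≡_ (λ x → Fin.punchOut (y≢f x))
  punched-inj e = f-inj (Finₚ.punchOut-injective (y≢f _) (y≢f _) e)

select : List Bool → List A → List A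
select []          _        = []
select (_ ∷ _)     []       = []
select (true ∷ m)  (z ∷ zs) = z ∷ select m zs
select (false ∷ m) (z ∷ zs) = select m zs

reject : List Bool → List A → List A
reject []          _        = []
reject (_ ∷ _)     []       = []
reject (true ∷ m)  (z ∷ zs) = reject m zs
reject (false ∷ m) (z ∷ zs) = z ∷ reject m zs

interleave-select-reject : ∀ m (zs : List A) → length zs ≡ length m →
                           interleave m (select m zs) (reject m zs) ≡ zs
interleave-select-reject []          []       _  = refl
interleave-select-reject (true ∷ m)  (z ∷ zs) eq =
  cong (z ∷_) (interleave-select-reject m zs (ℕₚ.suc-injective eq))
interleave-select-reject (false ∷ m) (z ∷ zs) eq =
  cong (z ∷_) (interleave-select-reject m zs (ℕₚ.suc-injective eq))

length-select+reject : ∀ m (zs : List A) → length zs ≡ length m →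
                       length (select m zs) + length (reject m zs) ≡ length zs
length-select+reject []          []       _  = refl
length-select+reject (true ∷ m)  (z ∷ zs) eq =
  cong suc (length-select+reject m zs (ℕₚ.suc-injective eq))
length-select+reject (false ∷ m) (z ∷ zs) eq =
  trans (ℕₚ.+-suc _ _) (cong suc (length-select+reject m zs (ℕₚ.suc-injective eq)))

interleave⁻ : ∀ m (xs ys : List A) →
              length xs + length ys ≡ length m → length (interleave m xs ys) ≡ length m →
              xs ≡ select m (interleave m xs ys) × ys ≡ reject m (interleave m xs ys)
interleave⁻ []          []       []       _   _  = refl , refl
interleave⁻ (true ∷ m)  (x ∷ xs) ys       |m| |z| =
  map₁ (cong (x ∷_)) (interleave⁻ m xs ys (ℕₚ.suc-injective |m|) (ℕₚ.suc-injective |z|))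
interleave⁻ (false ∷ m) xs       (y ∷ ys) |m| |z| =
  map₂ (cong (y ∷_)) (interleave⁻ m xs ys |m|′ (ℕₚ.suc-injective |z|))
  where |m|′ = ℕₚ.suc-injective (trans (sym (ℕₚ.+-suc _ _)) |m|)
interleave⁻ (true ∷ m)  []       ys       _   ()
interleave⁻ (false ∷ m) xs       []       _   ()
interleave⁻ []          (x ∷ xs) ys       ()  _
interleave⁻ []          []       (y ∷ ys) ()  _

module _ (g : A → Bool) (h : A → B) where

  select-map : ∀ xs → select (map g xs) (map h xs) ≡ map h (filter (T? ∘ g) xs)
  select-map []       = refl
  select-map (x ∷ xs) with g x
  ... | true  = cong (h x ∷_) (select-map xs)
  ... | false = select-map xs

  reject-map : ∀ xs → reject (map g xs) (map h xs) ≡ map h (filter (∁? (T? ∘ g)) xs)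
  reject-map []       = refl
  reject-map (x ∷ xs) with g x
  ... | true  = reject-map xs
  ... | false = cong (h x ∷_) (reject-map xs)

module _ {k n} {q : Fin n} (s : Vec (Fin n) k) where

  memb⁺ : q ∈ toList s → T (memb q s)
  memb⁺ q∈s = any⁺ _ (Any.map fromWitness q∈s)

  memb⁻ : T (memb q s) → q ∈ toList s
  memb⁻ q∈s = Any.map toWitness (any⁻ _ (toList s) q∈s)

filter-memb-allFin : ∀ {k n} (s : Vec (Fin n) k) → Increasing s →
                     filter (T? ∘ λ q → memb q s) (List.allFin n) ≡ toList s
filter-memb-allFin {n = n} s inc = strictlySorted-unique Finₚ.<-asym
  (AllPairs.filter⁺ ∈s? {List.allFin n} (AllPairs.tabulate⁺-< id))
  (increasing⇒sorted s inc)
  (λ q∈ → memb⁻ s (proj₂ (∈-filter⁻ ∈s? {xs = List.allFin n} q∈)))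
  (λ q∈s → ∈-filter⁺ ∈s? (∈-allFin _) (memb⁺ s q∈s))
  where ∈s? = T? ∘ λ q → memb q s

module Occurrences {k d : ℕ} (k≤ : k ≤ k + d)
                   (τ : Vec (Fin k) k) (τ-perm : IsPerm τ)
                   (π : Vec (Fin (k + d)) (k + d)) (π-perm : IsPerm π) where

  Word : ℕ → Set
  Word = Vec (Fin (k + d))

  words : ∀ m → List (Word m)
  words = allVec (List.allFin (k + d))

  -- sigma s w is definitionally interleave (positions s) (take k w) (drop k w).
  positions : Word k → List Bool
  positions s = map (λ q → memb q s) (List.allFin (k + d))

  inside : Word k → List (Fin (k + d))
  inside s = map (lookup π) (toList s)

  outside : Word k → List (Fin (k + d))
  outside s = reject (positions s) (toList π)

  π-injective : Injective _≡_ _≡_ (lookup π)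
  π-injective = unique⇒lookup-injective π π-perm

  length-positions : ∀ s → length (positions s) ≡ k + d
  length-positions s =
    trans (length-map (λ q → memb q s) (List.allFin (k + d))) (length-tabulate {n = k + d} id)

  length-π≡length-positions : ∀ s → length (toList π) ≡ length (positions s)
  length-π≡length-positions s = trans (length-toList π) (sym (length-positions s))

  length-inside : ∀ s → length (inside s) ≡ k
  length-inside s = trans (length-map _ (toList s)) (length-toList s)

  select-positions : ∀ s → Increasing s → select (positions s) (toList π) ≡ inside s
  select-positions s inc = begin
    select (positions s) (toList π)
      ≡⟨ cong (select (positions s)) (toList≡map-allFin π) ⟩
    select (positions s) (map (lookup π) (List.allFin _))
      ≡⟨ select-map _ (lookup π) (List.allFin _) ⟩
    map (lookup π) (filter (T? ∘ λ q → memb q s) (List.allFin _))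
      ≡⟨ cong (map (lookup π)) (filter-memb-allFin s inc) ⟩
    inside s ∎
    where open ≡-Reasoning

  outside≡map-filter : ∀ s →
    outside s ≡ map (lookup π) (filter (∁? (T? ∘ λ q → memb q s)) (List.allFin (k + d)))
  outside≡map-filter s = trans (cong (reject (positions s)) (toList≡map-allFin π))
                               (reject-map _ (lookup π) (List.allFin _))

  outside-unique : ∀ s → Unique (outside s)
  outside-unique s = subst Unique (sym (outside≡map-filter s))
    (Unique.map⁺ π-injective (Unique.filter⁺ _ (Unique.allFin⁺ _)))

  inside∉outside : ∀ s j → lookup π (lookup s j) ∉ outside s
  inside∉outside s j π[sj]∈
    with q , q∈ , π[sj]≡π[q] ← ∈-map⁻ (lookup π)
                                 (subst (lookup π (lookup s j) ∈_) (outside≡map-filter s) π[sj]∈) =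
    proj₂ (∈-filter⁻ (∁? (T? ∘ λ q → memb q s)) {xs = List.allFin (k + d)} q∈)
          (memb⁺ s (subst (_∈ toList s) (π-injective π[sj]≡π[q]) (∈-toList⁺ (∈-lookup j s))))

  length-outside : ∀ s → Increasing s → length (outside s) ≡ d
  length-outside s inc = ℕₚ.+-cancelˡ-≡ k _ _ (begin
    k + length (outside s)
      ≡⟨ cong (_+ length (outside s)) (trans (cong length (select-positions s inc)) (length-inside s)) ⟨
    length (select (positions s) (toList π)) + length (outside s)
      ≡⟨ length-select+reject (positions s) (toList π) (length-π≡length-positions s) ⟩
    length (toList π)
      ≡⟨ length-toList π ⟩
    k + d ∎)
    where open ≡-Reasoning

  sigma-inside-outside : ∀ s → Increasing s → sigma s (inside s ++ outside s) ≡ toList π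
  sigma-inside-outside s inc = begin
    interleave (positions s) (List.take k (inside s ++ outside s)) (List.drop k (inside s ++ outside s))
      ≡⟨ cong₂ (interleave (positions s))
               (take-++ _ _ (length-inside s)) (drop-++ _ _ (length-inside s)) ⟩
    interleave (positions s) (inside s) (outside s)
      ≡⟨ cong (λ xs → interleave (positions s) xs (outside s)) (select-positions s inc) ⟨
    interleave (positions s) (select (positions s) (toList π)) (outside s)
      ≡⟨ interleave-select-reject (positions s) (toList π) (length-π≡length-positions s) ⟩
    toList π ∎
    where open ≡-Reasoning

  sigma≡π⁻ : ∀ s → Increasing s → ∀ xs ys → length xs ≡ k → length ys ≡ d →
             sigma s (xs ++ ys) ≡ toList π → xs ≡ inside s × ys ≡ outside s
  sigma≡π⁻ s inc xs ys |xs| |ys| σ≡π =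
    trans xs≡ (trans (cong (select (positions s)) split≡π) (select-positions s inc)) ,
    trans ys≡ (cong (reject (positions s)) split≡π)
    where
    split≡π : interleave (positions s) xs ys ≡ toList π
    split≡π = trans (sym (cong₂ (interleave (positions s)) (take-++ xs ys |xs|) (drop-++ xs ys |xs|)))
                    σ≡π
    decoded = interleave⁻ (positions s) xs ys
      (trans (cong₂ _+_ |xs| |ys|) (sym (length-positions s)))
      (trans (cong length split≡π) (length-π≡length-positions s))
    xs≡ = proj₁ decoded
    ys≡ = proj₂ decoded

  bmap-++ : ∀ (x : Word k) (y : Word d) →
            bmap k≤ τ (x Vec.++ y) ≡ map (lookup x) (toList τ) ++ toList y
  bmap-++ x y = cong₂ _++_
    (map-cong (λ t → lookup-++-inject≤ x y t k≤) (toList τ))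
    (trans (cong (List.drop k) (toList-++ x y)) (drop-++ (toList x) (toList y) (length-toList x)))

  PlacedAt : Word k → Word k → Set
  PlacedAt x s = ∀ j → lookup x (lookup τ j) ≡ lookup π (lookup s j)

  contributes-++⁻ : ∀ x y s → Contributes k≤ τ π (x Vec.++ y , s) →
                    Increasing x × PlacedAt x s × toList y ≡ outside s
  contributes-++⁻ x y s ((_ , xy-inc) , s-inc , σ≡π) =
    (λ i j i<j → subst₂ Fin._<_ (ι i) (ι j) (xy-inc i j i<j)) ,
    map-toList-pointwise⁻ τ s (proj₁ decoded) ,
    proj₂ decoded
    where
    ι = λ i → lookup-++-inject≤ x y i k≤
    decoded = sigma≡π⁻ s s-inc _ (toList y)
      (trans (length-map _ (toList τ)) (length-toList τ)) (length-toList y)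
      (trans (cong (sigma s) (sym (bmap-++ x y))) σ≡π)

  contributes-++⁺ : ∀ x y s → IsPerm (x Vec.++ y) → Increasing x → Increasing s →
                    PlacedAt x s → toList y ≡ outside s → Contributes k≤ τ π (x Vec.++ y , s)
  contributes-++⁺ x y s perm x-inc s-inc placed y≡ =
    (perm , λ i j i<j → subst₂ Fin._<_ (sym (ι i)) (sym (ι j)) (x-inc i j i<j)) ,
    s-inc ,
    trans (cong (sigma s) (trans (bmap-++ x y) (cong₂ _++_ (map-toList-pointwise⁺ τ s placed) y≡)))
          (sigma-inside-outside s s-inc)
    where ι = λ i → lookup-++-inject≤ x y i k≤

  ≡take++drop : (a : Word (k + d)) → a ≡ Vec.take k a Vec.++ Vec.drop k a
  ≡take++drop a = sym (take++drop≡id k a)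

  contributes⁻ : ∀ a s → Contributes k≤ τ π (a , s) →
                 Increasing (Vec.take k a) × PlacedAt (Vec.take k a) s × toList (Vec.drop k a) ≡ outside s
  contributes⁻ a s c = contributes-++⁻ (Vec.take k a) (Vec.drop k a) s
    (subst (λ a → Contributes k≤ τ π (a , s)) (≡take++drop a) c)

  contributes⇒occurrence : ∀ {a s} → Contributes k≤ τ π (a , s) → Occurrence τ π s
  contributes⇒occurrence {a} {s} c@(_ , s-inc , _) with x-inc , placed , _ ← contributes⁻ a s c =
    s-inc , λ i j →
      (λ π<π → increasing⇒reflects-< (Vec.take k a) x-inc
                 (subst₂ Fin._<_ (sym (placed i)) (sym (placed j)) π<π)) ,
      (λ τ<τ → subst₂ Fin._<_ (placed i) (placed j) (x-inc _ _ τ<τ))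

  τ-surjective : ∀ t → ∃ λ j → lookup τ j ≡ t
  τ-surjective = injective⇒surjective (unique⇒lookup-injective τ τ-perm)

  contributions-unique : ∀ {a a′ s} →
    Contributes k≤ τ π (a , s) → Contributes k≤ τ π (a′ , s) → a ≡ a′
  contributions-unique {a} {a′} {s} c c′
    with _ , placed , y≡ ← contributes⁻ a s c
       | _ , placed′ , y′≡ ← contributes⁻ a′ s c′ = begin
      a                                   ≡⟨ ≡take++drop a ⟩
      Vec.take k a  Vec.++ Vec.drop k a   ≡⟨ cong₂ Vec._++_ x≡x′ y≡y′ ⟩
      Vec.take k a′ Vec.++ Vec.drop k a′  ≡⟨ ≡take++drop a′ ⟨
      a′                                  ∎
    where
    open ≡-Reasoning
    agree : ∀ t → lookup (Vec.take k a) t ≡ lookup (Vec.take k a′) t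
    agree t with j , refl ← τ-surjective t = trans (placed j) (sym (placed′ j))
    x≡x′ : Vec.take k a ≡ Vec.take k a′
    x≡x′ = trans (sym (tabulate∘lookup _)) (trans (tabulate-cong agree) (tabulate∘lookup _))
    y≡y′ : Vec.drop k a ≡ Vec.drop k a′
    y≡y′ = toList-injective-≡ (trans y≡ (sym y′≡))

  τ⁻¹ : Fin k → Fin k
  τ⁻¹ t = proj₁ (τ-surjective t)

  τ∘τ⁻¹ : ∀ t → lookup τ (τ⁻¹ t) ≡ t
  τ∘τ⁻¹ t = proj₂ (τ-surjective t)

  τ⁻¹∘τ : ∀ j → τ⁻¹ (lookup τ j) ≡ j
  τ⁻¹∘τ j = unique⇒lookup-injective τ τ-perm (τ∘τ⁻¹ (lookup τ j))

  -- For an occurrence s, the only contributing a: a_t = π_{s_{τ⁻¹ t}} for t < k, then π off S.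
  module Witness (s : Word k) (occ : Occurrence τ π s) where

    s-inc : Increasing s
    s-inc = proj₁ occ

    x₀ : Word k
    x₀ = Vec.tabulate (λ t → lookup π (lookup s (τ⁻¹ t)))

    y₀ : Word d
    y₀ = Vec.cast (length-outside s s-inc) (Vec.fromList (outside s))

    a₀ : Word (k + d)
    a₀ = x₀ Vec.++ y₀

    lookup-x₀ : ∀ t → lookup x₀ t ≡ lookup π (lookup s (τ⁻¹ t))
    lookup-x₀ = lookup∘tabulate _

    toList-y₀ : toList y₀ ≡ outside s
    toList-y₀ = trans (toList-cast _ (Vec.fromList (outside s))) (toList∘fromList (outside s))

    x₀-placed : PlacedAt x₀ s
    x₀-placed j = trans (lookup-x₀ (lookup τ j)) (cong (lookup π ∘ lookup s) (τ⁻¹∘τ j))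

    x₀-increasing : Increasing x₀
    x₀-increasing i j i<j = subst₂ Fin._<_ (sym (lookup-x₀ i)) (sym (lookup-x₀ j))
      (proj₂ (proj₂ occ (τ⁻¹ i) (τ⁻¹ j))
        (subst₂ Fin._<_ (sym (τ∘τ⁻¹ i)) (sym (τ∘τ⁻¹ j)) i<j))

    x₀-injective : Injective _≡_ _≡_ (lookup x₀)
    x₀-injective {i} {j} eq = begin
      i                 ≡⟨ τ∘τ⁻¹ i ⟨
      lookup τ (τ⁻¹ i)  ≡⟨ cong (lookup τ) (increasing⇒injective s s-inc (π-injective πs-eq)) ⟩
      lookup τ (τ⁻¹ j)  ≡⟨ τ∘τ⁻¹ j ⟩
      j                 ∎
      where
      open ≡-Reasoning
      πs-eq = trans (sym (lookup-x₀ i)) (trans eq (lookup-x₀ j))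

    x₀∉outside : ∀ {v} → v ∈ toList x₀ → v ∉ outside s
    x₀∉outside v∈x₀
      with t , refl ← ∈-tabulate⁻ (subst (_ ∈_) (toList≡tabulate x₀) v∈x₀) =
      subst (_∉ outside s) (sym (lookup-x₀ t)) (inside∉outside s (τ⁻¹ t))

    a₀-perm : IsPerm a₀
    a₀-perm = subst Unique (sym (toList-++ x₀ y₀)) (Unique.++⁺
      (subst Unique (sym (toList≡tabulate x₀)) (Unique.tabulate⁺ x₀-injective))
      (subst Unique (sym toList-y₀) (outside-unique s))
      (λ (v∈x₀ , v∈y₀) → x₀∉outside v∈x₀ (subst (_ ∈_) toList-y₀ v∈y₀)))

    a₀-contributes : Contributes k≤ τ π (a₀ , s)
    a₀-contributes = contributes-++⁺ x₀ y₀ s a₀-perm x₀-increasing s-inc x₀-placed toList-y₀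

  count-contributions : ∀ s →
    count (λ a → contributes? k≤ τ π (a , s)) (words (k + d)) ≡ indicator (occurrence? τ π s)
  count-contributions s with occurrence? τ π s
  ... | yes occ =
    count-unique (λ a → contributes? k≤ τ π (a , s))
      (allVec-unique (Unique.allFin⁺ _) _) (∈-allVec a₀ (All.universal (λ _ → ∈-allFin _) _))
      a₀-contributes (λ c → contributions-unique {s = s} c a₀-contributes)
    where open Witness s occ
  ... | no ¬occ =
    cong length (filter-none (λ a → contributes? k≤ τ π (a , s)) {words (k + d)}
      (All.universal (λ _ c → ¬occ (contributes⇒occurrence {s = s} c)) _))

  multiplicity≡occurrences : multiplicity k≤ τ π ≡ occurrences τ π
  multiplicity≡occurrences = begin
    count (contributes? k≤ τ π) (cartesianProduct (words (k + d)) (words k))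
      ≡⟨ count-cartesianProduct (contributes? k≤ τ π) (words (k + d)) (words k) ⟩
    sum (map (λ s → count (λ a → contributes? k≤ τ π (a , s)) (words (k + d))) (words k))
      ≡⟨ cong sum (map-cong count-contributions (words k)) ⟩
    sum (map (indicator ∘ occurrence? τ π) (words k))
      ≡⟨ count-as-sum (occurrence? τ π) (words k) ⟨
    occurrences τ π ∎
    where open ≡-Reasoning

mainTheorem1 : (k n : ℕ) → 1 ≤ k → (k≤n : k ≤ n) →
    (τ : Vec (Fin k) k) → IsPerm τ →
    (π : Vec (Fin n) n) → IsPerm π →
    multiplicity k≤n τ π ≡ occurrences τ π
mainTheorem1 k n _ k≤n τ τ-perm π π-perm with d , refl ← ℕₚ.m≤n⇒∃[o]m+o≡n k≤n =
  Occurrences.multiplicity≡occurrences k≤n τ τ-perm π π-perm
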